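{- Let $n$ be a non-negative integer and $p\in PC(n)$, with its operators labeled $1,\dots,2n$ by the depth-left first algorithm. Replace each label $i\in\{1,\dots,2n\}$ by the step $(1,1)$ if $i$ labels a coproduct and by the step $(1,-1)$ if $i$ labels a product. Then the resulting sequence of steps, read in the order $1,2,\dots,2n$ starting from $(0,0)$, is a Dyck path (it never goes below the horizontal axis and ends at $(2n,0)$).
   Context: A product-coproduct prograph is a finite connected planar directed graph, drawn in a horizontal strip with all edges oriented upward, whose nodes (operators) are coproducts (one input edge from below, two output edges upward, distinguished as left and right) and products (two input edges from below, distinguished as left and right, one output edge upward), with exactly one global input edge entering from the bottom and one global output edge leaving at the top; every other edge joins an output of a node to an input of a node. Prographs are taken up to planar isotopy; $PC(n)$ is the set of those with $n$ coproducts and $n$ products. Depth-left first labeling of operators: start by visiting the global input edge. Visiting an edge $e$ whose upper endpoint is the node $v$ proceeds as follows: if $v$ is a coproduct, give $v$ the next operator label, then visit its left output edge, then visit its right output edge; if $v$ is a product and only one of its input edges has been visited so far, return; if $v$ is a product and both its input edges have now been visited, give $v$ the next operator label and, unless the output of $v$ is the global output edge, visit the output edge of $v$. This labels the $2n$ operators with $1,\dots,2n$. -}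

module Defs where

open import Data.Nat using (ℕ; zero; suc; _+_; _*_; _≡ᵇ_)
open import Data.Bool using (Bool; true; false; if_then_else_; _∧_)
open import Data.List using (List; []; _∷_; _++_; [_]; map; foldr; take; length)
open import Data.Bool.ListAction using (any)
open import Data.Maybe using (Maybe; just; nothing)
open import Data.Product using (_×_; _,_; proj₁)
open import Data.Integer using (ℤ; 0ℤ; 1ℤ; -1ℤ) renaming (_+_ to _+ℤ_; _≤_ to _≤ℤ_)
open import Relation.Binary.PropositionalEquality using (_≡_)

-- A prograph drawn in a horizontal strip with all edges upward can be
-- put (by a planar isotopy) into generic position: all operators at
-- distinct heights.  Cutting the strip between consecutive operators
-- gives a "slice word": read from bottom to top, each letter is one
-- operator together with its position among the edges (wires) crossing
-- the strip at that height, counted from the left starting at 0.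
--   cop i  : the coproduct takes wire i as input and outputs two wires
--            (left output at position i, right output at position i+1)
--   prod i : the product takes wires i (left input) and i+1 (right
--            input) and outputs one wire at position i.
-- The single global input is the unique wire at the bottom; the word is
-- valid when every letter is applicable and exactly one wire (the global
-- output) remains at the top.  Node j is the j-th letter (0-based).

data Op : Set where
  cop  : ℕ → Op
  prod : ℕ → Op

-- output slot of a node: L/R = left/right output of a coproduct,
-- O = the output of a product
data Slot : Set where
  L R O : Slot

-- an edge is identified by its lower end
data Src : Set where
  gin : Src
  out : ℕ → Slot → Src

-- the upper end of an edge
data Tgt : Set where
  gout : Tgt
  inC  : ℕ → Tgt          -- the input of coproduct j
  inL  : ℕ → Tgt          -- the left input of product j
  inR  : ℕ → Tgt          -- the right input of product j

pick : {A : Set} → ℕ → List A → Maybe (List A × A × List A)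
pick _ [] = nothing
pick zero (x ∷ xs) = just ([] , x , xs)
pick (suc i) (x ∷ xs) with pick i xs
... | nothing = nothing
... | just (p , y , s) = just (x ∷ p , y , s)

edgesFrom : ℕ → List Src → List Op → Maybe (List (Src × Tgt))
edgesFrom j (s ∷ []) [] = just ((s , gout) ∷ [])
edgesFrom j _ [] = nothing
edgesFrom j ws (cop i ∷ w) with pick i ws
... | nothing = nothing
... | just (p , s , q) with edgesFrom (suc j) (p ++ out j L ∷ out j R ∷ q) w
...   | nothing = nothing
...   | just E = just ((s , inC j) ∷ E)
edgesFrom j ws (prod i ∷ w) with pick i ws
... | nothing = nothing
... | just (p , s , []) = nothing
... | just (p , s , s' ∷ q) with edgesFrom (suc j) (p ++ out j O ∷ q) w
...   | nothing = nothing
...   | just E = just ((s , inL j) ∷ (s' , inR j) ∷ E)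

edges : List Op → Maybe (List (Src × Tgt))
edges w = edgesFrom 0 (gin ∷ []) w

isCop : Op → Bool
isCop (cop _) = true
isCop (prod _) = false

countCop : List Op → ℕ
countCop [] = 0
countCop (o ∷ w) = (if isCop o then 1 else 0) + countCop w

countProd : List Op → ℕ
countProd [] = 0
countProd (o ∷ w) = (if isCop o then 0 else 1) + countProd w

slotEq : Slot → Slot → Bool
slotEq L L = true
slotEq R R = true
slotEq O O = true
slotEq _ _ = false

srcEq : Src → Src → Bool
srcEq gin gin = true
srcEq (out j a) (out k b) = (j ≡ᵇ k) ∧ slotEq a b
srcEq _ _ = false

tgtOf : List (Src × Tgt) → Src → Maybe Tgt
tgtOf [] e = nothing
tgtOf ((s , t) ∷ E) e = if srcEq s e then just t else tgtOf E e

-- State: (nodes labeled so far, in label order ; products of which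
-- exactly one input edge has been visited so far)
State : Set
State = List ℕ × List ℕ

-- visit an edge e.  The fuel bounds the recursion depth; each nested
-- call visits a strictly higher edge, so fuel ≥ number of edges + 1 is
-- never exhausted.
visit : ℕ → List (Src × Tgt) → Src → State → State
visit zero E e st = st
visit (suc f) E e (lab , seen) with tgtOf E e
... | nothing = (lab , seen)
... | just gout = (lab , seen)
... | just (inC j) =
        visit f E (out j R) (visit f E (out j L) (lab ++ [ j ] , seen))
... | just (inL j) = if any (j ≡ᵇ_) seen
                     then visit f E (out j O) (lab ++ [ j ] , seen)
                     else (lab , j ∷ seen)
... | just (inR j) = if any (j ≡ᵇ_) seen
                     then visit f E (out j O) (lab ++ [ j ] , seen)
                     else (lab , j ∷ seen)

-- the nodes (as indices into the word) in depth-left first label order: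
-- the k-th element of the list is the node receiving label k+1
labelOrder : List (Src × Tgt) → List ℕ
labelOrder E = proj₁ (visit (suc (length E)) E gin ([] , []))

-- step of node j: +1 for a coproduct (step (1,1)), -1 for a product
-- (step (1,-1)); 0 only for an index outside the word (never happens)
stepOf : List Op → ℕ → ℤ
stepOf [] _ = 0ℤ
stepOf (o ∷ w) zero = if isCop o then 1ℤ else -1ℤ
stepOf (o ∷ w) (suc j) = stepOf w j

steps : List Op → List (Src × Tgt) → List ℤ
steps w E = map (stepOf w) (labelOrder E)

sumℤ : List ℤ → ℤ
sumℤ = foldr _+ℤ_ 0ℤ

IsDyckPath : ℕ → List ℤ → Set
IsDyckPath n s =
  (length s ≡ 2 * n)
  × ((k : ℕ) → 0ℤ ≤ℤ sumℤ (take k s))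
  × (sumℤ s ≡ 0ℤ)

-- The depth-left first traversal labels an operator only once all its input edges have been
-- visited, and it visits an edge only from a labeled operator (or the global input).  Hence
-- every prefix P of the label order is down-closed: the inputs of an operator of P leave the
-- global input or P.  Sweeping the slices upward, a coproduct of P consumes one wire leaving
-- {global input} ∪ P and creates two, a product of P consumes two and creates one, and one such
-- wire survives until the global output; so P has no more products than coproducts, i.e. the
-- path stays above the axis.  The label order lists every operator exactly once, which gives
-- the length 2n and the final height n − n = 0.
module Submission where

open import Defs
open import Data.Nat using (ℕ; zero; suc; _+_; _*_; _≤_; _<_; z≤n; s≤s; z<s; _≡ᵇ_; pred)
open import Data.Nat.Induction using (<-rec)
open import Data.Nat.Properties
  using (≤-refl; ≤-trans; <-trans; <⇒≤; 1+n≰n; m<m+n; ≤-reflexive; <-irrefl; m≤n⇒m≤1+n; m≤n⇒m<n∨m≡n; +-suc; +-identityʳ;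
         +-monoʳ-≤; +-monoˡ-≤; pred-mono-≤; m≤n+m; ≡ᵇ⇒≡; ≡⇒≡ᵇ; _≟_; +-commutativeSemigroup)
import Algebra.Properties.CommutativeSemigroup as CommutativeSemigroupProperties
open CommutativeSemigroupProperties +-commutativeSemigroup using (x∙yz≈y∙xz; interchange)
open import Data.Integer as Int using (0ℤ; _⊖_) renaming (_+_ to _+ℤ_; _≤_ to _≤ℤ_)
import Data.Integer.Properties as ℤ
open CommutativeSemigroupProperties ℤ.+-commutativeSemigroup using () renaming (interchange to +ℤ-interchange)
open import Data.Nat.ListAction using (sum)
open import Data.Bool using (Bool; true; false; T; if_then_else_)
open import Data.Bool.Properties using (T-≡)
open import Data.Bool.ListAction using (any)
open import Data.List using (List; []; _∷_; _++_; [_]; map; length; take)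
open import Data.List.Properties using (++-assoc; ++-identityʳ; take-map; length-map; take-[]; take-all; map-cong)
open import Data.List.Membership.Propositional using (_∈_; _∉_)
open import Data.List.Membership.Propositional.Properties using (∈-map⁺; ∈-map⁻; ∈-++⁺ˡ; ∈-++⁺ʳ; ∈-++⁻)
open import Data.List.Relation.Unary.Any using (here; there)
import Data.List.Relation.Unary.Any as Any
open import Data.List.Relation.Unary.Any.Properties using (any⁺; any⁻)
open import Data.List.Relation.Unary.All.Properties using (¬Any⇒All¬; All¬⇒¬Any)
open import Data.List.Relation.Unary.AllPairs using ([]; _∷_)
open import Data.List.Relation.Unary.Unique.Propositional using (Unique)
open import Data.List.Relation.Unary.Unique.Propositional.Properties using (Unique[x∷xs]⇒x∉xs; ++⁺)
import Data.List.Relation.Unary.Unique.Propositional.Properties as Unique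
open import Data.Maybe using (Maybe; just; nothing)
open import Data.Maybe.Properties using (just-injective)
open import Data.Product using (_×_; _,_; proj₁; proj₂; ∃-syntax)
import Data.Product as Product
open import Data.Sum using (_⊎_; inj₁; inj₂)
import Data.Sum as Sum
open import Data.Empty using (⊥; ⊥-elim)
open import Relation.Nullary using (¬_; yes; no)
open import Relation.Unary using (_∪_; ｛_｝)
open import Function using (_∘_; Equivalence)
open import Relation.Binary.PropositionalEquality using (_≡_; refl; sym; trans; cong; cong₂; subst; _≢_; module ≡-Reasoning)

private variable
  j k : ℕ
  sl : Slot
  ws : List Src
  w : List Op
  E : List (Src × Tgt)
  x s s′ : Src
  t t′ : Tgt

∈-split : ∀ {A : Set} {x s : A} p q → x ∈ p ++ s ∷ q → x ∈ p ⊎ x ≡ s ⊎ x ∈ q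
∈-split p q x∈ with ∈-++⁻ p x∈
... | inj₁ x∈p = inj₁ x∈p
... | inj₂ (here x≡s) = inj₂ (inj₁ x≡s)
... | inj₂ (there x∈q) = inj₂ (inj₂ x∈q)

∈-unsplit : ∀ {A : Set} {x s : A} p q → x ∈ p ⊎ x ∈ q → x ∈ p ++ s ∷ q
∈-unsplit p q (inj₁ x∈p) = ∈-++⁺ˡ x∈p
∈-unsplit p q (inj₂ x∈q) = ∈-++⁺ʳ p (there x∈q)

∈-insert : ∀ {A : Set} {x s : A} p q → x ∈ p ++ q → x ∈ p ++ s ∷ q
∈-insert p q x∈ = ∈-unsplit p q (∈-++⁻ p x∈)

∈-insert₂ : ∀ {A : Set} {x s s′ : A} p q → x ∈ p ++ q → x ∈ p ++ s ∷ s′ ∷ q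
∈-insert₂ p q x∈ = ∈-insert p _ (∈-insert p q x∈)

unique-∷ : ∀ {A : Set} {x : A} {xs} → x ∉ xs → Unique xs → Unique (x ∷ xs)
unique-∷ {xs = xs} x∉xs u = ¬Any⇒All¬ xs x∉xs ∷ u

unique-remove : ∀ {A : Set} (p : List A) {s q} → Unique (p ++ s ∷ q) → s ∉ p ++ q × Unique (p ++ q)
unique-remove [] u@(_ ∷ u′) = Unique[x∷xs]⇒x∉xs u , u′
unique-remove (y ∷ p) {s} {q} (y∉ ∷ u) with unique-remove p u
... | s∉ , u′ = s∉y∷ , unique-∷ (λ y∈ → All¬⇒¬Any y∉ (∈-insert p q y∈)) u′
  where
    s∉y∷ : s ∉ y ∷ p ++ q
    s∉y∷ (here refl) = All¬⇒¬Any y∉ (∈-++⁺ʳ p (here refl))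
    s∉y∷ (there s∈) = s∉ s∈

unique-insert : ∀ {A : Set} (p : List A) {s q} → s ∉ p ++ q → Unique (p ++ q) → Unique (p ++ s ∷ q)
unique-insert [] s∉ u = unique-∷ s∉ u
unique-insert (y ∷ p) {s} {q} s∉ (y∉ ∷ u) =
  unique-∷ y∉y∷ (unique-insert p (λ s∈ → s∉ (there s∈)) u)
  where
    y∉y∷ : y ∉ p ++ s ∷ q
    y∉y∷ y∈ with ∈-split p q y∈
    ... | inj₁ y∈p = All¬⇒¬Any y∉ (∈-++⁺ˡ y∈p)
    ... | inj₂ (inj₁ refl) = s∉ (here refl)
    ... | inj₂ (inj₂ y∈q) = All¬⇒¬Any y∉ (∈-++⁺ʳ p y∈q)

unique-map⇒injective : ∀ {A B : Set} (f : A → B) {xs x y} → Unique (map f xs) → x ∈ xs → y ∈ xs → f x ≡ f y → x ≡ y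
unique-map⇒injective f (_ ∷ _) (here refl) (here refl) _ = refl
unique-map⇒injective f {_ ∷ zs} (fz∉ ∷ _) (here refl) (there y∈) fx≡fy =
  ⊥-elim (All¬⇒¬Any fz∉ (subst (_∈ map f zs) (sym fx≡fy) (∈-map⁺ f y∈)))
unique-map⇒injective f {_ ∷ zs} (fz∉ ∷ _) (there x∈) (here refl) fx≡fy =
  ⊥-elim (All¬⇒¬Any fz∉ (subst (_∈ map f zs) fx≡fy (∈-map⁺ f x∈)))
unique-map⇒injective f (_ ∷ u) (there x∈) (there y∈) fx≡fy = unique-map⇒injective f u x∈ y∈ fx≡fy

_∈ᵇ_ : ℕ → List ℕ → Bool
k ∈ᵇ P = any (k ≡ᵇ_) P

∈ᵇ⇒∈ : ∀ {k} P → T (k ∈ᵇ P) → k ∈ P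
∈ᵇ⇒∈ P t = Any.map (≡ᵇ⇒≡ _ _) (any⁻ _ P t)

∈⇒∈ᵇ : ∀ {k P} → k ∈ P → T (k ∈ᵇ P)
∈⇒∈ᵇ k∈ = any⁺ _ (Any.map (≡⇒≡ᵇ _ _) k∈)

∉⇒∈ᵇ≡false : ∀ {k} P → k ∉ P → (k ∈ᵇ P) ≡ false
∉⇒∈ᵇ≡false {k} P k∉ with k ∈ᵇ P in k∈ᵇP
... | false = refl
... | true  = ⊥-elim (k∉ (∈ᵇ⇒∈ P (Equivalence.from T-≡ k∈ᵇP)))

data EdgesFrom : ℕ → List Src → List Op → List (Src × Tgt) → Set where
  output    : ∀ {j s} → EdgesFrom j [ s ] [] [ (s , gout) ]
  coproduct : ∀ {j i w p s q E} → EdgesFrom (suc j) (p ++ out j L ∷ out j R ∷ q) w E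
            → EdgesFrom j (p ++ s ∷ q) (cop i ∷ w) ((s , inC j) ∷ E)
  product   : ∀ {j i w p s s′ q E} → EdgesFrom (suc j) (p ++ out j O ∷ q) w E
            → EdgesFrom j (p ++ s ∷ s′ ∷ q) (prod i ∷ w) ((s , inL j) ∷ (s′ , inR j) ∷ E)

pick-split : ∀ {A : Set} i (xs : List A) {p s q} → pick i xs ≡ just (p , s , q) → xs ≡ p ++ s ∷ q
pick-split i       []       ()
pick-split zero    (x ∷ xs) refl = refl
pick-split (suc i) (x ∷ xs) eq with pick i xs in picked
pick-split (suc i) (x ∷ xs) refl | just _ = cong (x ∷_) (pick-split i xs picked)

coproductAt : ∀ {j i ws w p s q E} → ws ≡ p ++ s ∷ q → EdgesFrom (suc j) (p ++ out j L ∷ out j R ∷ q) w E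
            → EdgesFrom j ws (cop i ∷ w) ((s , inC j) ∷ E)
coproductAt refl = coproduct

productAt : ∀ {j i ws w p s s′ q E} → ws ≡ p ++ s ∷ s′ ∷ q → EdgesFrom (suc j) (p ++ out j O ∷ q) w E
          → EdgesFrom j ws (prod i ∷ w) ((s , inL j) ∷ (s′ , inR j) ∷ E)
productAt refl = product

-- The wires are split as in edgesFrom, whose first clause singles out a one-wire list.
edgesFrom⇒EdgesFrom : ∀ j ws w {E} → edgesFrom j ws w ≡ just E → EdgesFrom j ws w E
edgesFrom⇒EdgesFrom j (s ∷ []) [] refl = output
edgesFrom⇒EdgesFrom j [] [] ()
edgesFrom⇒EdgesFrom j (_ ∷ _ ∷ _) [] ()
edgesFrom⇒EdgesFrom j [] (cop i ∷ w) ()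
edgesFrom⇒EdgesFrom j [] (prod i ∷ w) ()
edgesFrom⇒EdgesFrom j ws@(_ ∷ []) (cop i ∷ w) eq with pick i ws in picked
... | just (p , s , q) with edgesFrom (suc j) (p ++ out j L ∷ out j R ∷ q) w in rest
...   | just _ with eq
...     | refl = coproductAt (pick-split i ws picked) (edgesFrom⇒EdgesFrom (suc j) _ w rest)
edgesFrom⇒EdgesFrom j ws@(_ ∷ _ ∷ _) (cop i ∷ w) eq with pick i ws in picked
... | just (p , s , q) with edgesFrom (suc j) (p ++ out j L ∷ out j R ∷ q) w in rest
...   | just _ with eq
...     | refl = coproductAt (pick-split i ws picked) (edgesFrom⇒EdgesFrom (suc j) _ w rest)
edgesFrom⇒EdgesFrom j ws@(_ ∷ []) (prod i ∷ w) eq with pick i ws in picked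
... | just (p , s , s′ ∷ q) with edgesFrom (suc j) (p ++ out j O ∷ q) w in rest
...   | just _ with eq
...     | refl = productAt (pick-split i ws picked) (edgesFrom⇒EdgesFrom (suc j) _ w rest)
edgesFrom⇒EdgesFrom j ws@(_ ∷ _ ∷ _) (prod i ∷ w) eq with pick i ws in picked
... | just (p , s , s′ ∷ q) with edgesFrom (suc j) (p ++ out j O ∷ q) w in rest
...   | just _ with eq
...     | refl = productAt (pick-split i ws picked) (edgesFrom⇒EdgesFrom (suc j) _ w rest)

-- The first slice that can consume the edge; edges only enter operators at or above their level.
level : Src → ℕ
level gin = 0
level (out k _) = suc k

targetNode : Tgt → Maybe ℕ
targetNode gout = nothing
targetNode (inC k) = just k
targetNode (inL k) = just k
targetNode (inR k) = just k

_∋_↦_ : List (Src × Tgt) → Src → Tgt → Set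
E ∋ s ↦ t = (s , t) ∈ E

IntoProduct : List (Src × Tgt) → Src → ℕ → Set
IntoProduct E s k = E ∋ s ↦ inL k ⊎ E ∋ s ↦ inR k

Into : List (Src × Tgt) → Src → ℕ → Set
Into E s k = E ∋ s ↦ inC k ⊎ IntoProduct E s k

into-target : Into E s k → ∃[ t ] (E ∋ s ↦ t × targetNode t ≡ just k)
into-target (inj₁ e) = _ , e , refl
into-target (inj₂ (inj₁ e)) = _ , e , refl
into-target (inj₂ (inj₂ e)) = _ , e , refl

Below : ℕ → List Src → Set
Below j ws = ∀ {x} → x ∈ ws → level x ≤ j

wires-coproduct : ∀ p q → x ∈ p ++ out j L ∷ out j R ∷ q → x ∈ p ++ q ⊎ x ≡ out j L ⊎ x ≡ out j R
wires-coproduct p q x∈ with ∈-split p _ x∈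
... | inj₁ x∈p = inj₁ (∈-++⁺ˡ x∈p)
... | inj₂ (inj₁ refl) = inj₂ (inj₁ refl)
... | inj₂ (inj₂ (here refl)) = inj₂ (inj₂ refl)
... | inj₂ (inj₂ (there x∈q)) = inj₁ (∈-++⁺ʳ p x∈q)

wires-product : ∀ p q → x ∈ p ++ out j O ∷ q → x ∈ p ++ q ⊎ x ≡ out j O
wires-product p q x∈ with ∈-split p q x∈
... | inj₁ x∈p = inj₁ (∈-++⁺ˡ x∈p)
... | inj₂ (inj₁ refl) = inj₂ refl
... | inj₂ (inj₂ x∈q) = inj₁ (∈-++⁺ʳ p x∈q)

below-coproduct : ∀ p q → Below j (p ++ s ∷ q) → Below (suc j) (p ++ out j L ∷ out j R ∷ q)
below-coproduct p q below x∈ with wires-coproduct p q x∈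
... | inj₁ x∈pq = m≤n⇒m≤1+n (below (∈-insert p q x∈pq))
... | inj₂ (inj₁ refl) = ≤-refl
... | inj₂ (inj₂ refl) = ≤-refl

below-product : ∀ p q → Below j (p ++ s ∷ s′ ∷ q) → Below (suc j) (p ++ out j O ∷ q)
below-product p q below x∈ with wires-product p q x∈
... | inj₁ x∈pq = m≤n⇒m≤1+n (below (∈-insert₂ p q x∈pq))
... | inj₂ refl = ≤-refl

new-output-∉ : Below j ws → out j sl ∉ ws
new-output-∉ below x∈ = 1+n≰n (below x∈)

length≤edges : EdgesFrom j ws w E → length w ≤ length E
length≤edges output = z≤n
length≤edges (coproduct r) = s≤s (length≤edges r)
length≤edges (product r) = s≤s (m≤n⇒m≤1+n (length≤edges r))

range-here : ∀ {n} → j ≤ j × j < j + suc n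
range-here {j} = ≤-refl , m<m+n j z<s

range-there : ∀ {n} → suc j ≤ k × k < suc j + n → j ≤ k × k < j + suc n
range-there {j} {k} {n} (j<k , k<) = <⇒≤ j<k , subst (k <_) (sym (+-suc j n)) k<

target-range : EdgesFrom j ws w E → E ∋ s ↦ t → targetNode t ≡ just k → j ≤ k × k < j + length w
target-range output (here refl) ()
target-range (coproduct r) (here refl) refl = range-here
target-range (coproduct r) (there e) t↦k = range-there (target-range r e t↦k)
target-range (product r) (here refl) refl = range-here
target-range (product r) (there (here refl)) refl = range-here
target-range (product r) (there (there e)) t↦k = range-there (target-range r e t↦k)

target-before : EdgesFrom (suc j) ws w E → E ∋ s ↦ t → targetNode t ≡ just j → ⊥
target-before r e t↦j = 1+n≰n (proj₁ (target-range r e t↦j))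

target-before-∉ : EdgesFrom (suc j) ws w E → targetNode t ≡ just j → t ∉ map proj₂ E
target-before-∉ r t↦j t∈ with ∈-map⁻ proj₂ t∈
... | _ , e , refl = target-before r e t↦j

source-origin : EdgesFrom j ws w E → E ∋ s ↦ t → s ∈ ws ⊎ j < level s
source-origin output (here refl) = inj₁ (here refl)
source-origin (coproduct {p = p} r) (here refl) = inj₁ (∈-++⁺ʳ p (here refl))
source-origin (coproduct {p = p} {q = q} r) (there e) with source-origin r e
... | inj₂ j<level = inj₂ (<⇒≤ j<level)
... | inj₁ s∈ with wires-coproduct p q s∈
...   | inj₁ s∈pq = inj₁ (∈-insert p q s∈pq)
...   | inj₂ (inj₁ refl) = inj₂ ≤-refl
...   | inj₂ (inj₂ refl) = inj₂ ≤-refl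
source-origin (product {p = p} r) (here refl) = inj₁ (∈-++⁺ʳ p (here refl))
source-origin (product {p = p} r) (there (here refl)) = inj₁ (∈-++⁺ʳ p (there (here refl)))
source-origin (product {p = p} {q = q} r) (there (there e)) with source-origin r e
... | inj₂ j<level = inj₂ (<⇒≤ j<level)
... | inj₁ s∈ with wires-product p q s∈
...   | inj₁ s∈pq = inj₁ (∈-insert₂ p q s∈pq)
...   | inj₂ refl = inj₂ ≤-refl

source-level : Below j ws → EdgesFrom j ws w E → E ∋ s ↦ t → targetNode t ≡ just k → level s ≤ k
source-level below output (here refl) ()
source-level below (coproduct {p = p} r) (here refl) refl = below (∈-++⁺ʳ p (here refl))
source-level below (coproduct {p = p} {q = q} r) (there e) = source-level (below-coproduct p q below) r e
source-level below (product {p = p} r) (here refl) refl = below (∈-++⁺ʳ p (here refl))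
source-level below (product {p = p} r) (there (here refl)) refl = below (∈-++⁺ʳ p (there (here refl)))
source-level below (product {p = p} {q = q} r) (there (there e)) = source-level (below-product p q below) r e

absent⇒not-source : EdgesFrom (suc j) ws w E → level x ≤ j → x ∉ ws → x ∉ map proj₁ E
absent⇒not-source r x≤j x∉ x∈ with ∈-map⁻ proj₁ x∈
... | _ , e , refl with source-origin r e
...   | inj₁ x∈ws = x∉ x∈ws
...   | inj₂ j<x = 1+n≰n (≤-trans j<x (m≤n⇒m≤1+n x≤j))

sources-unique : Unique ws → Below j ws → EdgesFrom j ws w E → Unique (map proj₁ E)
sources-unique u below output = unique-∷ (λ ()) []
sources-unique {j = j} u below (coproduct {p = p} {s = s} {q = q} r) =
  unique-∷ (absent⇒not-source r s≤j s∉) (sources-unique u′ (below-coproduct p q below) r)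
  where
    s∉pq = proj₁ (unique-remove p u)
    below-pq : Below j (p ++ q)
    below-pq x∈ = below (∈-insert p q x∈)
    s≤j = below (∈-++⁺ʳ p (here refl))
    s∉ : s ∉ p ++ out j L ∷ out j R ∷ q
    s∉ s∈ with wires-coproduct p q s∈
    ... | inj₁ s∈pq = s∉pq s∈pq
    ... | inj₂ (inj₁ refl) = 1+n≰n s≤j
    ... | inj₂ (inj₂ refl) = 1+n≰n s≤j
    L∉ : out j L ∉ p ++ out j R ∷ q
    L∉ L∈ with ∈-split p q L∈
    ... | inj₁ L∈p = new-output-∉ below-pq (∈-++⁺ˡ L∈p)
    ... | inj₂ (inj₂ L∈q) = new-output-∉ below-pq (∈-++⁺ʳ p L∈q)
    u′ = unique-insert p L∉ (unique-insert p (new-output-∉ below-pq) (proj₂ (unique-remove p u)))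
sources-unique {j = j} u below (product {p = p} {s = s} {s′ = s′} {q = q} r) =
  unique-∷ s∉ (unique-∷ (absent⇒not-source r s′≤j (gone s′∉pq s′≤j))
    (sources-unique u′ (below-product p q below) r))
  where
    s∉pq′ = proj₁ (unique-remove p u)
    u-pq′ = proj₂ (unique-remove p u)
    s′∉pq = proj₁ (unique-remove p u-pq′)
    below-pq : Below j (p ++ q)
    below-pq x∈ = below (∈-insert₂ p q x∈)
    gone : x ∉ p ++ q → level x ≤ j → x ∉ p ++ out j O ∷ q
    gone x∉ x≤j x∈ with wires-product p q x∈
    ... | inj₁ x∈pq = x∉ x∈pq
    ... | inj₂ refl = 1+n≰n x≤j
    s≤j = below (∈-++⁺ʳ p (here refl))
    s′≤j = below (∈-++⁺ʳ p (there (here refl)))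
    s∉ : s ∉ s′ ∷ map proj₁ _
    s∉ (here refl) = s∉pq′ (∈-++⁺ʳ p (here refl))
    s∉ (there s∈) = absent⇒not-source r s≤j (gone (λ s∈pq → s∉pq′ (∈-insert p q s∈pq)) s≤j) s∈
    u′ = unique-insert p (new-output-∉ below-pq) (proj₂ (unique-remove p u-pq′))

targets-unique : EdgesFrom j ws w E → Unique (map proj₂ E)
targets-unique output = unique-∷ (λ ()) []
targets-unique (coproduct r) = unique-∷ (target-before-∉ r refl) (targets-unique r)
targets-unique (product r) =
  unique-∷ (λ { (here ()) ; (there inL∈) → target-before-∉ r refl inL∈ })
    (unique-∷ (target-before-∉ r refl) (targets-unique r))

coproduct-target : EdgesFrom j ws w E → E ∋ s ↦ inC k → E ∋ s′ ↦ t → targetNode t ≡ just k → t ≡ inC k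
coproduct-target output (here ()) _ _
coproduct-target (coproduct r) (here refl) (here refl) _ = refl
coproduct-target (coproduct r) (here refl) (there e) t↦k = ⊥-elim (target-before r e t↦k)
coproduct-target (coproduct r) (there c) (here refl) refl = ⊥-elim (target-before r c refl)
coproduct-target (coproduct r) (there c) (there e) t↦k = coproduct-target r c e t↦k
coproduct-target (product r) (there (there c)) (here refl) refl = ⊥-elim (target-before r c refl)
coproduct-target (product r) (there (there c)) (there (here refl)) refl = ⊥-elim (target-before r c refl)
coproduct-target (product r) (there (there c)) (there (there e)) t↦k = coproduct-target r c e t↦k

BothInputs : List (Src × Tgt) → ℕ → Set
BothInputs E k = (∃[ s ] (E ∋ s ↦ inL k)) × (∃[ s′ ] (E ∋ s′ ↦ inR k))

both-inputs-there : ∀ {e} → BothInputs E k → BothInputs (e ∷ E) k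
both-inputs-there = Product.map (Product.map₂ there) (Product.map₂ there)

both-inputs : EdgesFrom j ws w E → IntoProduct E s k → BothInputs E k
both-inputs output (inj₁ (here ()))
both-inputs output (inj₂ (here ()))
both-inputs (coproduct r) (inj₁ (there e)) = both-inputs-there (both-inputs r (inj₁ e))
both-inputs (coproduct r) (inj₂ (there e)) = both-inputs-there (both-inputs r (inj₂ e))
both-inputs (product r) (inj₁ (here refl)) = (_ , here refl) , (_ , there (here refl))
both-inputs (product r) (inj₂ (there (here refl))) = (_ , here refl) , (_ , there (here refl))
both-inputs (product r) (inj₁ (there (there e))) = both-inputs-there (both-inputs-there (both-inputs r (inj₁ e)))
both-inputs (product r) (inj₂ (there (there e))) = both-inputs-there (both-inputs-there (both-inputs r (inj₂ e)))

every-operator-has-input : EdgesFrom j ws w E → j ≤ k → k < j + length w → ∃[ s ] (E ∋ s ↦ inC k ⊎ E ∋ s ↦ inL k)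
every-operator-has-input {j = j} output j≤k k< = ⊥-elim (1+n≰n (≤-trans k< (≤-trans (≤-reflexive (+-identityʳ j)) j≤k)))
every-operator-has-input {j = j} {w = _ ∷ w} {k = k} (coproduct r) j≤k k< with m≤n⇒m<n∨m≡n j≤k
... | inj₂ refl = _ , inj₁ (here refl)
... | inj₁ j<k = Product.map₂ (Sum.map there there) (every-operator-has-input r j<k (subst (k <_) (+-suc j (length w)) k<))
every-operator-has-input {j = j} {w = _ ∷ w} {k = k} (product r) j≤k k< with m≤n⇒m<n∨m≡n j≤k
... | inj₂ refl = _ , inj₂ (here refl)
... | inj₁ j<k =
  Product.map₂ (Sum.map (there ∘ there) (there ∘ there)) (every-operator-has-input r j<k (subst (k <_) (+-suc j (length w)) k<))

OutputSlot : List (Src × Tgt) → ℕ → Slot → Set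
OutputSlot E k sl = ((∃[ s ] (E ∋ s ↦ inC k)) × (sl ≡ L ⊎ sl ≡ R)) ⊎ ((∃[ s ] (E ∋ s ↦ inL k)) × sl ≡ O)

output-slot-there : ∀ {e} → OutputSlot E k sl → OutputSlot (e ∷ E) k sl
output-slot-there = Sum.map (Product.map₁ (Product.map₂ there)) (Product.map₁ (Product.map₂ there))

output-slot : EdgesFrom j ws w E → E ∋ out k sl ↦ t → out k sl ∈ ws ⊎ OutputSlot E k sl
output-slot output (here refl) = inj₁ (here refl)
output-slot (coproduct {p = p} r) (here refl) = inj₁ (∈-++⁺ʳ p (here refl))
output-slot (coproduct {p = p} {q = q} r) (there e) with output-slot r e
... | inj₂ slot = inj₂ (output-slot-there slot)
... | inj₁ x∈ with wires-coproduct p q x∈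
...   | inj₁ x∈pq = inj₁ (∈-insert p q x∈pq)
...   | inj₂ (inj₁ refl) = inj₂ (inj₁ ((_ , here refl) , inj₁ refl))
...   | inj₂ (inj₂ refl) = inj₂ (inj₁ ((_ , here refl) , inj₂ refl))
output-slot (product {p = p} r) (here refl) = inj₁ (∈-++⁺ʳ p (here refl))
output-slot (product {p = p} r) (there (here refl)) = inj₁ (∈-++⁺ʳ p (there (here refl)))
output-slot (product {p = p} {q = q} r) (there (there e)) with output-slot r e
... | inj₂ slot = inj₂ (output-slot-there (output-slot-there slot))
... | inj₁ x∈ with wires-product p q x∈
...   | inj₁ x∈pq = inj₁ (∈-insert₂ p q x∈pq)
...   | inj₂ refl = inj₂ (inj₂ ((_ , here refl) , refl))

record Prograph (E : List (Src × Tgt)) (N : ℕ) : Set where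
  field
    functional        : E ∋ s ↦ t → E ∋ s ↦ t′ → t ≡ t′
    injective         : E ∋ s ↦ t → E ∋ s′ ↦ t → s ≡ s′
    into-level        : Into E s k → level s ≤ k
    into-bounded      : Into E s k → k < N
    has-input         : k < N → ∃[ s ] (E ∋ s ↦ inC k ⊎ E ∋ s ↦ inL k)
    coproduct≢product : E ∋ s ↦ inC k → ¬ IntoProduct E s′ k
    product-inputs    : IntoProduct E s k → BothInputs E k
    output-kind       : E ∋ out k sl ↦ t → OutputSlot E k sl
    enough-edges      : N ≤ length E

prograph : EdgesFrom 0 [ gin ] w E → Prograph E (length w)
prograph {E = E} r = record
  { functional        = λ e e′ → cong proj₂ (unique-map⇒injective proj₁ (sources-unique (unique-∷ (λ ()) []) below-gin r) e e′ refl)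
  ; injective         = λ e e′ → cong proj₁ (unique-map⇒injective proj₂ (targets-unique r) e e′ refl)
  ; into-level        = λ into → let _ , e , t↦k = into-target into in source-level below-gin r e t↦k
  ; into-bounded      = λ into → let _ , e , t↦k = into-target into in proj₂ (target-range r e t↦k)
  ; has-input         = every-operator-has-input r z≤n
  ; coproduct≢product = no-mixing
  ; product-inputs    = both-inputs r
  ; output-kind       = kind
  ; enough-edges      = length≤edges r
  }
  where
    below-gin : Below 0 [ gin ]
    below-gin (here refl) = z≤n
    no-mixing : E ∋ s ↦ inC k → ¬ IntoProduct E s′ k
    no-mixing c (inj₁ l) with coproduct-target r c l refl
    ... | ()
    no-mixing c (inj₂ r′) with coproduct-target r c r′ refl
    ... | ()
    kind : E ∋ out k sl ↦ t → OutputSlot E k sl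
    kind e with output-slot r e
    ... | inj₁ (here ())
    ... | inj₂ slot = slot

≡ᵇ-refl : ∀ n → (n ≡ᵇ n) ≡ true
≡ᵇ-refl n = Equivalence.to T-≡ (≡⇒≡ᵇ n n refl)

slotEq-sound : ∀ a b → slotEq a b ≡ true → a ≡ b
slotEq-sound L L _ = refl
slotEq-sound R R _ = refl
slotEq-sound O O _ = refl

srcEq-sound : ∀ a b → srcEq a b ≡ true → a ≡ b
srcEq-sound gin gin _ = refl
srcEq-sound (out j a) (out k b) eq with j ≡ᵇ k in j≡ᵇk
... | true rewrite ≡ᵇ⇒≡ j k (Equivalence.from T-≡ j≡ᵇk) | slotEq-sound a b eq = refl

srcEq-refl : ∀ a → srcEq a a ≡ true
srcEq-refl gin = refl
srcEq-refl (out j L) rewrite ≡ᵇ-refl j = refl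
srcEq-refl (out j R) rewrite ≡ᵇ-refl j = refl
srcEq-refl (out j O) rewrite ≡ᵇ-refl j = refl

tgtOf-sound : ∀ E s → tgtOf E s ≡ just t → E ∋ s ↦ t
tgtOf-sound ((s₀ , t₀) ∷ E) s eq with srcEq s₀ s in s₀≡s
... | false = there (tgtOf-sound E s eq)
... | true with srcEq-sound s₀ s s₀≡s | eq
...   | refl | refl = here refl

tgtOf-nothing : ∀ E s → tgtOf E s ≡ nothing → ¬ E ∋ s ↦ t
tgtOf-nothing ((s₀ , t₀) ∷ E) s eq e with srcEq s₀ s in s₀≡s
tgtOf-nothing ((s₀ , t₀) ∷ E) s () e | true
tgtOf-nothing ((s₀ , t₀) ∷ E) s eq (there e) | false = tgtOf-nothing E s eq e
tgtOf-nothing ((s₀ , t₀) ∷ E) s eq (here refl) | false with trans (sym (srcEq-refl s)) s₀≡s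
... | ()

data From (P : List ℕ) : Src → Set where
  global : From P gin
  node   : k ∈ P → From P (out k sl)

from-++ : ∀ {P} Q → From P s → From (P ++ Q) s
from-++ Q global = global
from-++ Q (node k∈) = node (∈-++⁺ˡ k∈)

DownClosed : List (Src × Tgt) → List ℕ → Set
DownClosed E P = ∀ {k s} → k ∈ P → Into E s k → From P s

record IsLinearExtension (E : List (Src × Tgt)) (N : ℕ) (P : List ℕ) : Set where
  field
    unique   : Unique P
    bounded  : ∀ {k} → k ∈ P → k < N
    complete : ∀ {k} → k < N → k ∈ P
    prefixes : ∀ m → DownClosed E (take m P)

take-∷ʳ : ∀ {A : Set} m (xs : List A) y → take m (xs ++ [ y ]) ≡ take m xs ⊎ take m (xs ++ [ y ]) ≡ xs ++ [ y ]
take-∷ʳ zero    xs       y = inj₁ refl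
take-∷ʳ (suc m) []       y = inj₂ (cong (y ∷_) (take-[] m))
take-∷ʳ (suc m) (x ∷ xs) y = Sum.map (cong (x ∷_)) (cong (x ∷_)) (take-∷ʳ m xs y)

data OutOf (X : List ℕ) : Src → Set where
  out∈ : k ∈ X → OutOf X (out k sl)

module Traversal {E : List (Src × Tgt)} {N : ℕ} (G : Prograph E N) where
  open Prograph G

  private variable
    lab seen : List ℕ
    V : Src → Set
    e : Src

  into-node-unique : Into E s k → Into E s j → k ≡ j
  into-node-unique into into′ with into-target into | into-target into′
  ... | _ , e , t↦k | _ , e′ , t↦j rewrite functional e e′ = just-injective (trans (sym t↦k) t↦j)

  -- V is the set of edges visited so far; visit does not record it.
  record Invariant (lab seen : List ℕ) (V : Src → Set) : Set where
    field
      unique                 : Unique lab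
      bounded                : ∀ {k} → k ∈ lab → k < N
      visited⇒from-labeled   : ∀ {s} → V s → From lab s
      labeled⇒inputs-visited : ∀ {k s} → k ∈ lab → Into E s k → V s
      inputs-visited⇒labeled : ∀ {k} → ∃[ s ] Into E s k → (∀ {s} → Into E s k → V s) → k ∈ lab
      seen⇒input-visited     : ∀ {k} → k ∈ seen → ∃[ s ] (IntoProduct E s k × V s)
      input-visited⇒seen     : ∀ {k s} → IntoProduct E s k → V s → k ∈ seen
      prefixes               : ∀ m → DownClosed E (take m lab)

    labeled-closed : DownClosed E lab
    labeled-closed = subst (DownClosed E) (take-all (length lab) lab ≤-refl) (prefixes (length lab))

  other-operator-input : k ≢ j → Into E e j → (∀ {s} → Into E s k → (V ∪ ｛ e ｝) s) → Into E s k → V s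
  other-operator-input k≢j into-e inputs into with inputs into
  ... | inj₁ v = v
  ... | inj₂ refl = ⊥-elim (k≢j (into-node-unique into into-e))

  label : Invariant lab seen V → Into E e k → ¬ V e → From lab e
        → (∀ {s} → Into E s k → (V ∪ ｛ e ｝) s) → (∀ {j} → IntoProduct E e j → j ∈ seen)
        → Invariant (lab ++ [ k ]) seen (V ∪ ｛ e ｝)
  label {lab = lab} {V = V} {e = e} {k = k} inv into-e e∉V from-e inputs e-seen = record
    { unique                 = ++⁺ unique (unique-∷ (λ ()) []) (λ { (k∈ , here refl) → k∉lab k∈ })
    ; bounded                = bounded′
    ; visited⇒from-labeled   = λ { (inj₁ v) → from-++ [ k ] (visited⇒from-labeled v)
                                 ; (inj₂ refl) → from-++ [ k ] from-e }
    ; labeled⇒inputs-visited = labeled⇒inputs-visited′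
    ; inputs-visited⇒labeled = inputs-visited⇒labeled′
    ; seen⇒input-visited     = Product.map₂ (Product.map₂ inj₁) ∘ seen⇒input-visited
    ; input-visited⇒seen     = λ { p (inj₁ v) → input-visited⇒seen p v ; p (inj₂ refl) → e-seen p }
    ; prefixes               = prefixes′
    }
    where
      open Invariant inv
      k∉lab : k ∉ lab
      k∉lab k∈ = e∉V (labeled⇒inputs-visited k∈ into-e)
      bounded′ : ∀ {j} → j ∈ lab ++ [ k ] → j < N
      bounded′ j∈ with ∈-++⁻ lab j∈
      ... | inj₁ j∈lab = bounded j∈lab
      ... | inj₂ (here refl) = into-bounded into-e
      labeled⇒inputs-visited′ : ∀ {j s} → j ∈ lab ++ [ k ] → Into E s j → (V ∪ ｛ e ｝) s
      labeled⇒inputs-visited′ j∈ into with ∈-++⁻ lab j∈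
      ... | inj₁ j∈lab = inj₁ (labeled⇒inputs-visited j∈lab into)
      ... | inj₂ (here refl) = inputs into
      inputs-visited⇒labeled′ : ∀ {j} → ∃[ s ] Into E s j → (∀ {s} → Into E s j → (V ∪ ｛ e ｝) s) → j ∈ lab ++ [ k ]
      inputs-visited⇒labeled′ {j} has all with j ≟ k
      ... | yes refl = ∈-++⁺ʳ lab (here refl)
      ... | no j≢k = ∈-++⁺ˡ (inputs-visited⇒labeled has (other-operator-input j≢k into-e all))
      closed : DownClosed E (lab ++ [ k ])
      closed j∈ into with ∈-++⁻ lab j∈
      ... | inj₁ j∈lab = from-++ [ k ] (labeled-closed j∈lab into)
      ... | inj₂ (here refl) with inputs into
      ...   | inj₁ v = from-++ [ k ] (visited⇒from-labeled v)
      ...   | inj₂ refl = from-++ [ k ] from-e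
      prefixes′ : ∀ m → DownClosed E (take m (lab ++ [ k ]))
      prefixes′ m with take-∷ʳ m lab k
      ... | inj₁ eq rewrite eq = prefixes m
      ... | inj₂ eq rewrite eq = closed

  inL≢inR : inL k ≢ inR k
  inL≢inR ()

  other-input : IntoProduct E e k → ∃[ s ] (IntoProduct E s k × e ≢ s)
  other-input p@(inj₁ l) with product-inputs p
  ... | _ , (s₂ , r) = s₂ , inj₂ r , λ { refl → inL≢inR (functional l r) }
  other-input p@(inj₂ r) with product-inputs p
  ... | (s₁ , l) , _ = s₁ , inj₁ l , λ { refl → inL≢inR (functional l r) }

  wait : Invariant lab seen V → IntoProduct E e k → ¬ V e → From lab e → k ∉ seen
       → Invariant lab (k ∷ seen) (V ∪ ｛ e ｝)
  wait {lab = lab} {V = V} {e = e} {k = k} inv p-e e∉V from-e k∉seen = record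
    { unique                 = unique
    ; bounded                = bounded
    ; visited⇒from-labeled   = λ { (inj₁ v) → visited⇒from-labeled v ; (inj₂ refl) → from-e }
    ; labeled⇒inputs-visited = λ j∈ into → inj₁ (labeled⇒inputs-visited j∈ into)
    ; inputs-visited⇒labeled = inputs-visited⇒labeled′
    ; seen⇒input-visited     = λ { (here refl) → e , p-e , inj₂ refl
                                 ; (there j∈) → Product.map₂ (Product.map₂ inj₁) (seen⇒input-visited j∈) }
    ; input-visited⇒seen     = λ { p (inj₁ v) → there (input-visited⇒seen p v)
                                 ; p (inj₂ refl) → here (into-node-unique (inj₂ p) (inj₂ p-e)) }
    ; prefixes               = prefixes
    }
    where
      open Invariant inv
      inputs-visited⇒labeled′ : ∀ {j} → ∃[ s ] Into E s j → (∀ {s} → Into E s j → (V ∪ ｛ e ｝) s) → j ∈ lab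
      inputs-visited⇒labeled′ {j} has all with j ≟ k
      ... | no j≢k = inputs-visited⇒labeled has (other-operator-input j≢k (inj₂ p-e) all)
      ... | yes refl with other-input p-e
      ...   | s₂ , p₂ , e≢s₂ with all (inj₂ p₂)
      ...     | inj₁ s₂∈V = ⊥-elim (k∉seen (input-visited⇒seen p₂ s₂∈V))
      ...     | inj₂ e≡s₂ = ⊥-elim (e≢s₂ e≡s₂)

  ignore : Invariant lab seen V → (∀ {k} → ¬ Into E e k) → From lab e → Invariant lab seen (V ∪ ｛ e ｝)
  ignore {V = V} {e = e} inv dead from-e = record
    { unique                 = unique
    ; bounded                = bounded
    ; visited⇒from-labeled   = λ { (inj₁ v) → visited⇒from-labeled v ; (inj₂ refl) → from-e }
    ; labeled⇒inputs-visited = λ j∈ into → inj₁ (labeled⇒inputs-visited j∈ into)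
    ; inputs-visited⇒labeled = λ has all → inputs-visited⇒labeled has (λ into → not-e into (all into))
    ; seen⇒input-visited     = Product.map₂ (Product.map₂ inj₁) ∘ seen⇒input-visited
    ; input-visited⇒seen     = λ { p (inj₁ v) → input-visited⇒seen p v ; p (inj₂ refl) → ⊥-elim (dead (inj₂ p)) }
    ; prefixes               = prefixes
    }
    where
      open Invariant inv
      not-e : Into E s k → (V ∪ ｛ e ｝) s → V s
      not-e into (inj₁ v) = v
      not-e into (inj₂ refl) = ⊥-elim (dead into)

  record Visited (lab : List ℕ) (V : Src → Set) (e : Src) (st : State) : Set₁ where
    field
      V′        : Src → Set
      invariant : Invariant (proj₁ st) (proj₂ st) V′
      new       : List ℕ
      extends   : proj₁ st ≡ lab ++ new
      monotone  : ∀ {s} → V s → V′ s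
      hit       : V′ e
      only      : ∀ {s} → V′ s → (V ∪ ｛ e ｝) s ⊎ OutOf new s
      outputs   : ∀ {k sl t} → k ∈ new → E ∋ out k sl ↦ t → V′ (out k sl)

  unchanged : ∀ {seen′} → Invariant lab seen′ (V ∪ ｛ e ｝) → Visited lab V e (lab , seen′)
  unchanged inv = record
    { V′ = _ ∪ ｛ _ ｝ ; invariant = inv ; new = [] ; extends = sym (++-identityʳ _)
    ; monotone = inj₁ ; hit = inj₂ refl ; only = inj₁ ; outputs = λ () }

  -- The fuel suffices because every recursive call visits an edge of higher level.
  VisitOK : ℕ → Set₁
  VisitOK f = ∀ {lab seen V e} → Invariant lab seen V → ¬ V e → From lab e → level e ≤ N → N < level e + f
            → Visited lab V e (visit f E e (lab , seen))

  fuel-step : ∀ {f} → level e ≤ j → N < level e + suc f → N < suc j + f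
  fuel-step {e = e} {f = f} e≤j fuel = ≤-trans (subst (N <_) (+-suc (level e) f) fuel) (s≤s (+-monoˡ-≤ f e≤j))

  fresh-output : Invariant lab seen V → j ∉ lab → From lab e → ¬ (V ∪ ｛ e ｝) (out j sl)
  fresh-output inv j∉lab from-e (inj₁ v) with Invariant.visited⇒from-labeled inv v
  ... | node j∈ = j∉lab j∈
  fresh-output inv j∉lab (node j∈) (inj₂ refl) = j∉lab j∈

  visit-first-output : ∀ {f} → VisitOK f → Invariant lab seen V → Into E e j → ¬ V e → From lab e
                     → (∀ {s} → Into E s j → (V ∪ ｛ e ｝) s) → (∀ {k} → IntoProduct E e k → k ∈ seen)
                     → N < level e + suc f
                     → Visited (lab ++ [ j ]) (V ∪ ｛ e ｝) (out j sl) (visit f E (out j sl) (lab ++ [ j ] , seen))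
  visit-first-output {lab = lab} ih inv into-e e∉V from-e inputs e-seen fuel =
    ih (label inv into-e e∉V from-e inputs e-seen) (fresh-output inv j∉lab from-e)
       (node (∈-++⁺ʳ lab (here refl))) (into-bounded into-e) (fuel-step (into-level into-e) fuel)
    where
      j∉lab = λ j∈ → e∉V (Invariant.labeled⇒inputs-visited inv j∈ into-e)

  coproduct-inputs : E ∋ e ↦ inC j → Into E s j → (V ∪ ｛ e ｝) s
  coproduct-inputs c (inj₁ c′) = inj₂ (injective c c′)
  coproduct-inputs c (inj₂ p) = ⊥-elim (coproduct≢product c p)

  coproduct-input-not-product : E ∋ e ↦ inC j → ¬ IntoProduct E e k
  coproduct-input-not-product c (inj₁ l) with functional c l
  ... | ()
  coproduct-input-not-product c (inj₂ r) with functional c r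
  ... | ()

  coproduct-step : ∀ {f} → VisitOK f → Invariant lab seen V → ¬ V e → From lab e → E ∋ e ↦ inC j
                 → N < level e + suc f
                 → Visited lab V e (visit f E (out j R) (visit f E (out j L) (lab ++ [ j ] , seen)))
  coproduct-step {lab = lab} {seen = seen} {V = V} {e = e} {j = j} {f} ih inv e∉V from-e c fuel = record
    { V′        = V₂.V′
    ; invariant = V₂.invariant
    ; new       = j ∷ V₁.new ++ V₂.new
    ; extends   = extends
    ; monotone  = V₂.monotone ∘ V₁.monotone ∘ inj₁
    ; hit       = V₂.monotone (V₁.monotone (inj₂ refl))
    ; only      = only
    ; outputs   = outputs
    }
    where
      st₁ = visit f E (out j L) (lab ++ [ j ] , seen)
      module V₁ = Visited (visit-first-output ih inv (inj₁ c) e∉V from-e (coproduct-inputs {V = V} c)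
                                             (⊥-elim ∘ coproduct-input-not-product c) fuel)
      j∈st₁ : j ∈ proj₁ st₁
      j∈st₁ = subst (j ∈_) (sym V₁.extends) (∈-++⁺ˡ (∈-++⁺ʳ lab (here refl)))
      R∉V₁ : ¬ V₁.V′ (out j R)
      R∉V₁ v with V₁.only v
      ... | inj₁ (inj₂ ())
      ... | inj₁ (inj₁ v′) = fresh-output inv (λ j∈ → e∉V (Invariant.labeled⇒inputs-visited inv j∈ (inj₁ c))) from-e v′
      ... | inj₂ (out∈ j∈new) = proj₁ (unique-remove lab unique₁) (∈-++⁺ʳ lab j∈new)
        where unique₁ = subst Unique (trans V₁.extends (++-assoc lab [ j ] V₁.new)) (Invariant.unique V₁.invariant)
      module V₂ = Visited (ih V₁.invariant R∉V₁ (node j∈st₁) (into-bounded (inj₁ c)) (fuel-step (into-level (inj₁ c)) fuel))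
      extends : proj₁ (visit f E (out j R) st₁) ≡ lab ++ j ∷ V₁.new ++ V₂.new
      extends = begin
        proj₁ (visit f E (out j R) st₁)      ≡⟨ V₂.extends ⟩
        proj₁ st₁ ++ V₂.new                  ≡⟨ cong (_++ V₂.new) V₁.extends ⟩
        ((lab ++ [ j ]) ++ V₁.new) ++ V₂.new ≡⟨ ++-assoc (lab ++ [ j ]) V₁.new V₂.new ⟩
        (lab ++ [ j ]) ++ V₁.new ++ V₂.new   ≡⟨ ++-assoc lab [ j ] (V₁.new ++ V₂.new) ⟩
        lab ++ j ∷ V₁.new ++ V₂.new          ∎
        where open ≡-Reasoning
      only : V₂.V′ s → (V ∪ ｛ e ｝) s ⊎ OutOf (j ∷ V₁.new ++ V₂.new) s
      only v with V₂.only v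
      ... | inj₁ (inj₂ refl) = inj₂ (out∈ (here refl))
      ... | inj₂ (out∈ k∈) = inj₂ (out∈ (there (∈-++⁺ʳ V₁.new k∈)))
      ... | inj₁ (inj₁ v₁) with V₁.only v₁
      ...   | inj₁ (inj₁ v₀) = inj₁ v₀
      ...   | inj₁ (inj₂ refl) = inj₂ (out∈ (here refl))
      ...   | inj₂ (out∈ k∈) = inj₂ (out∈ (there (∈-++⁺ˡ k∈)))
      outputs : k ∈ j ∷ V₁.new ++ V₂.new → E ∋ out k sl ↦ t → V₂.V′ (out k sl)
      outputs (here refl) o with output-kind o
      ... | inj₁ (_ , inj₁ refl) = V₂.monotone V₁.hit
      ... | inj₁ (_ , inj₂ refl) = V₂.hit
      ... | inj₂ ((_ , l) , _) = ⊥-elim (coproduct≢product c (inj₁ l))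
      outputs (there k∈) o with ∈-++⁻ V₁.new k∈
      ... | inj₁ k∈₁ = V₂.monotone (V₁.outputs k∈₁ o)
      ... | inj₂ k∈₂ = V₂.outputs k∈₂ o

  two-of-three : IntoProduct E s k → IntoProduct E s′ k → IntoProduct E x k → s ≡ s′ ⊎ s ≡ x ⊎ s′ ≡ x
  two-of-three (inj₁ a) (inj₁ b) _ = inj₁ (injective a b)
  two-of-three (inj₂ a) (inj₂ b) _ = inj₁ (injective a b)
  two-of-three (inj₁ a) (inj₂ b) (inj₁ c) = inj₂ (inj₁ (injective a c))
  two-of-three (inj₁ a) (inj₂ b) (inj₂ c) = inj₂ (inj₂ (injective b c))
  two-of-three (inj₂ a) (inj₁ b) (inj₁ c) = inj₂ (inj₂ (injective b c))
  two-of-three (inj₂ a) (inj₁ b) (inj₂ c) = inj₂ (inj₁ (injective a c))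

  second-product-input : IntoProduct E e j → ¬ V e → ∃[ s ] (IntoProduct E s j × V s) → Into E s j → (V ∪ ｛ e ｝) s
  second-product-input p e∉V (s₁ , p₁ , v₁) (inj₁ c) = ⊥-elim (coproduct≢product c p)
  second-product-input p e∉V (s₁ , p₁ , v₁) (inj₂ p′) with two-of-three p p′ p₁
  ... | inj₁ e≡s = inj₂ e≡s
  ... | inj₂ (inj₁ refl) = ⊥-elim (e∉V v₁)
  ... | inj₂ (inj₂ refl) = inj₁ v₁

  product-step : ∀ {f} → VisitOK f → Invariant lab seen V → ¬ V e → From lab e → IntoProduct E e j
               → N < level e + suc f
               → Visited lab V e (if any (j ≡ᵇ_) seen then visit f E (out j O) (lab ++ [ j ] , seen)
                                                      else (lab , j ∷ seen))
  product-step {lab = lab} {seen = seen} {V = V} {e = e} {j = j} ih inv e∉V from-e p fuel with any (j ≡ᵇ_) seen in j∈ᵇseen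
  ... | false = unchanged (wait inv p e∉V from-e (λ j∈ → subst T j∈ᵇseen (∈⇒∈ᵇ j∈)))
  ... | true  = record
    { V′        = V₁.V′
    ; invariant = V₁.invariant
    ; new       = j ∷ V₁.new
    ; extends   = trans V₁.extends (++-assoc lab [ j ] V₁.new)
    ; monotone  = V₁.monotone ∘ inj₁
    ; hit       = V₁.monotone (inj₂ refl)
    ; only      = only
    ; outputs   = outputs
    }
    where
      j∈seen = ∈ᵇ⇒∈ seen (Equivalence.from T-≡ j∈ᵇseen)
      e-seen : IntoProduct E e k → k ∈ seen
      e-seen p′ rewrite into-node-unique (inj₂ p′) (inj₂ p) = j∈seen
      module V₁ = Visited (visit-first-output ih inv (inj₂ p) e∉V from-e
                            (second-product-input p e∉V (Invariant.seen⇒input-visited inv j∈seen)) e-seen fuel)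
      only : V₁.V′ s → (V ∪ ｛ e ｝) s ⊎ OutOf (j ∷ V₁.new) s
      only v with V₁.only v
      ... | inj₁ (inj₁ v₀) = inj₁ v₀
      ... | inj₁ (inj₂ refl) = inj₂ (out∈ (here refl))
      ... | inj₂ (out∈ k∈) = inj₂ (out∈ (there k∈))
      outputs : k ∈ j ∷ V₁.new → E ∋ out k sl ↦ t → V₁.V′ (out k sl)
      outputs (here refl) o with output-kind o
      ... | inj₁ ((_ , c) , _) = ⊥-elim (coproduct≢product c p)
      ... | inj₂ (_ , refl) = V₁.hit
      outputs (there k∈) o = V₁.outputs k∈ o

  dead-end : tgtOf E e ≡ nothing ⊎ tgtOf E e ≡ just gout → ¬ Into E e k
  dead-end {e = e} (inj₁ none) into = tgtOf-nothing E e none (proj₁ (proj₂ (into-target into)))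
  dead-end {e = e} (inj₂ gout↤) into with into-target into
  ... | _ , e↦ , t↦k with functional (tgtOf-sound E e gout↤) e↦
  ... | refl with t↦k
  ... | ()

  visit-ok : ∀ f → VisitOK f
  visit-ok zero {e = e} _ _ _ e≤N fuel = ⊥-elim (1+n≰n (≤-trans fuel (≤-trans (≤-reflexive (+-identityʳ (level e))) e≤N)))
  visit-ok (suc f) {e = e} inv e∉V from-e _ fuel with tgtOf E e in e↦
  ... | nothing      = unchanged (ignore inv (dead-end (inj₁ e↦)) from-e)
  ... | just gout    = unchanged (ignore inv (dead-end (inj₂ e↦)) from-e)
  ... | just (inC j) = coproduct-step (visit-ok f) inv e∉V from-e (tgtOf-sound E e e↦) fuel
  ... | just (inL j) = product-step (visit-ok f) inv e∉V from-e (inj₁ (tgtOf-sound E e e↦)) fuel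
  ... | just (inR j) = product-step (visit-ok f) inv e∉V from-e (inj₂ (tgtOf-sound E e e↦)) fuel

  initial : Invariant [] [] (λ _ → ⊥)
  initial = record
    { unique       = []
    ; bounded      = λ ()
    ; visited⇒from-labeled = λ ()
    ; labeled⇒inputs-visited  = λ ()
    ; inputs-visited⇒labeled  = λ (_ , into) all → ⊥-elim (all into)
    ; seen⇒input-visited = λ ()
    ; input-visited⇒seen = λ _ ()
    ; prefixes     = λ m → subst (DownClosed E) (sym (take-[] m)) (λ ())
    }

  open Visited (visit-ok (suc (length E)) initial (λ ()) global z≤n (s≤s enough-edges))

  labelOrder-complete : k < N → k ∈ labelOrder E
  labelOrder-complete {k} = <-rec (λ k → k < N → k ∈ labelOrder E) step k
    where
      step : ∀ k → (∀ {i} → i < k → i < N → i ∈ labelOrder E) → k < N → k ∈ labelOrder E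
      step k earlier k<N = Invariant.inputs-visited⇒labeled invariant (Product.map₂ (Sum.map₂ inj₁) (has-input k<N)) visited
        where
          visited : Into E s k → V′ s
          visited {gin} _ = hit
          visited {out i sl} into =
            outputs (subst (i ∈_) extends (earlier (into-level into) (<-trans (into-level into) k<N)))
                    (proj₁ (proj₂ (into-target into)))

  labelOrder-isLinearExtension : IsLinearExtension E N (labelOrder E)
  labelOrder-isLinearExtension = record
    { unique   = Invariant.unique invariant
    ; bounded  = Invariant.bounded invariant
    ; complete = labelOrder-complete
    ; prefixes = Invariant.prefixes invariant
    }

open Traversal using (labelOrder-isLinearExtension)

copWeight prodWeight : Op → ℕ
copWeight o = if isCop o then 1 else 0
prodWeight o = if isCop o then 0 else 1

-- The word starts at operator j; operators outside it weigh 0.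
weightAt : (Op → ℕ) → ℕ → List Op → ℕ → ℕ
weightAt v j []      k = 0
weightAt v j (o ∷ w) k = if j ≡ᵇ k then v o else weightAt v (suc j) w k

weightOf : (Op → ℕ) → ℕ → List Op → List ℕ → ℕ
weightOf v j []      P = 0
weightOf v j (o ∷ w) P = (if j ∈ᵇ P then v o else 0) + weightOf v (suc j) w P

weightAt-suc : ∀ v j w k → weightAt v (suc j) w (suc k) ≡ weightAt v j w k
weightAt-suc v j []      k = refl
weightAt-suc v j (o ∷ w) k with j ≡ᵇ k
... | true  = refl
... | false = weightAt-suc v (suc j) w k

weightAt-before : ∀ v j w k → k < j → weightAt v j w k ≡ 0
weightAt-before v j []      k k<j = refl
weightAt-before v j (o ∷ w) k k<j with j ≡ᵇ k in j≡ᵇk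
... | true  = ⊥-elim (<-irrefl (sym (≡ᵇ⇒≡ j k (Equivalence.from T-≡ j≡ᵇk))) k<j)
... | false = weightAt-before v (suc j) w k (m≤n⇒m≤1+n k<j)

weightOf-[] : ∀ v j w → weightOf v j w [] ≡ 0
weightOf-[] v j []      = refl
weightOf-[] v j (o ∷ w) = weightOf-[] v (suc j) w

weightOf-∷ : ∀ v j w {x P} → x ∉ P → weightOf v j w (x ∷ P) ≡ weightAt v j w x + weightOf v j w P
weightOf-∷ v j []      x∉P = refl
weightOf-∷ v j (o ∷ w) {x} {P} x∉P with j ≡ᵇ x in j≡ᵇx
... | true with ≡ᵇ⇒≡ j x (Equivalence.from T-≡ j≡ᵇx)
...   | refl rewrite weightOf-∷ v (suc j) w x∉P | weightAt-before v (suc j) w j ≤-refl | ∉⇒∈ᵇ≡false P x∉P = refl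
weightOf-∷ v j (o ∷ w) {x} {P} x∉P | false rewrite weightOf-∷ v (suc j) w x∉P =
  x∙yz≈y∙xz (if j ∈ᵇ P then v o else 0) (weightAt v (suc j) w x) (weightOf v (suc j) w P)

sum-weightAt : ∀ v j w {P} → Unique P → sum (map (weightAt v j w) P) ≡ weightOf v j w P
sum-weightAt v j w {[]}    _         = sym (weightOf-[] v j w)
sum-weightAt v j w {x ∷ P} (x∉ ∷ u) = begin
  weightAt v j w x + sum (map (weightAt v j w) P) ≡⟨ cong (weightAt v j w x +_) (sum-weightAt v j w u) ⟩
  weightAt v j w x + weightOf v j w P             ≡⟨ weightOf-∷ v j w (All¬⇒¬Any x∉) ⟨
  weightOf v j w (x ∷ P)                          ∎
  where open ≡-Reasoning

weightOf-covered : ∀ v j w {P} → (∀ {k} → j ≤ k → k < j + length w → k ∈ P) → weightOf v j w P ≡ sum (map v w)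
weightOf-covered v j []      covered = refl
weightOf-covered v j (o ∷ w) covered
  rewrite Equivalence.to T-≡ (∈⇒∈ᵇ (covered ≤-refl (m<m+n j z<s))) =
  cong (v o +_) (weightOf-covered v (suc j) w λ {k} j<k k< → covered (<⇒≤ j<k) (subst (k <_) (sym (+-suc j (length w))) k<))

countCop≡ : ∀ w → countCop w ≡ sum (map copWeight w)
countCop≡ []      = refl
countCop≡ (o ∷ w) = cong (copWeight o +_) (countCop≡ w)

countProd≡ : ∀ w → countProd w ≡ sum (map prodWeight w)
countProd≡ []      = refl
countProd≡ (o ∷ w) = cong (prodWeight o +_) (countProd≡ w)

weightAt-cop+prod : ∀ w {k} → k < length w → weightAt copWeight 0 w k + weightAt prodWeight 0 w k ≡ 1
weightAt-cop+prod (cop _  ∷ w) {zero}  _ = refl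
weightAt-cop+prod (prod _ ∷ w) {zero}  _ = refl
weightAt-cop+prod (o ∷ w)      {suc k} (s≤s k<)
  rewrite weightAt-suc copWeight 0 w k | weightAt-suc prodWeight 0 w k = weightAt-cop+prod w k<

stepOf≡ : ∀ w k → stepOf w k ≡ weightAt copWeight 0 w k ⊖ weightAt prodWeight 0 w k
stepOf≡ []           k       = refl
stepOf≡ (cop _  ∷ w) zero    = refl
stepOf≡ (prod _ ∷ w) zero    = refl
stepOf≡ (o ∷ w)      (suc k)
  rewrite weightAt-suc copWeight 0 w k | weightAt-suc prodWeight 0 w k = stepOf≡ w k

length≡cops+prods : ∀ w {P} → Unique P → (∀ {k} → k ∈ P → k < length w)
                  → length P ≡ weightOf copWeight 0 w P + weightOf prodWeight 0 w P
length≡cops+prods w {[]} _ _ = sym (cong₂ _+_ (weightOf-[] copWeight 0 w) (weightOf-[] prodWeight 0 w))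
length≡cops+prods w {x ∷ P} (x∉ ∷ u) bounded = begin
  1 + length P                          ≡⟨ cong₂ _+_ (sym (weightAt-cop+prod w (bounded (here refl))))
                                                     (length≡cops+prods w u (bounded ∘ there)) ⟩
  (c x + p x) + (C P + Q P)             ≡⟨ interchange (c x) (p x) (C P) (Q P) ⟩
  (c x + C P) + (p x + Q P)             ≡⟨ cong₂ _+_ (weightOf-∷ copWeight 0 w (All¬⇒¬Any x∉))
                                                     (weightOf-∷ prodWeight 0 w (All¬⇒¬Any x∉)) ⟨
  C (x ∷ P) + Q (x ∷ P)                 ∎
  where
    open ≡-Reasoning
    c = weightAt copWeight 0 w
    p = weightAt prodWeight 0 w
    C = weightOf copWeight 0 w
    Q = weightOf prodWeight 0 w

⊖-+-⊖ : ∀ a b c d → (a ⊖ b) +ℤ (c ⊖ d) ≡ (a + c) ⊖ (b + d)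
⊖-+-⊖ a b c d = begin
  (a ⊖ b) +ℤ (c ⊖ d)                                     ≡⟨ cong₂ _+ℤ_ (ℤ.m-n≡m⊖n a b) (ℤ.m-n≡m⊖n c d) ⟨
  (Int.+ a +ℤ Int.- Int.+ b) +ℤ (Int.+ c +ℤ Int.- Int.+ d) ≡⟨ +ℤ-interchange (Int.+ a) (Int.- Int.+ b) (Int.+ c) (Int.- Int.+ d) ⟩
  (Int.+ a +ℤ Int.+ c) +ℤ (Int.- Int.+ b +ℤ Int.- Int.+ d) ≡⟨ cong₂ _+ℤ_ (ℤ.pos-+ a c) (-pos-+ b d) ⟨
  Int.+ (a + c) +ℤ Int.- Int.+ (b + d)                     ≡⟨ ℤ.m-n≡m⊖n (a + c) (b + d) ⟩
  (a + c) ⊖ (b + d)                                        ∎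
  where
    open ≡-Reasoning
    -pos-+ : ∀ m n → Int.- Int.+ (m + n) ≡ Int.- Int.+ m +ℤ Int.- Int.+ n
    -pos-+ m n = trans (cong Int.-_ (ℤ.pos-+ m n)) (ℤ.neg-distrib-+ (Int.+ m) (Int.+ n))

sumℤ-⊖ : ∀ {A : Set} (f g : A → ℕ) xs → sumℤ (map (λ x → f x ⊖ g x) xs) ≡ sum (map f xs) ⊖ sum (map g xs)
sumℤ-⊖ f g []       = refl
sumℤ-⊖ f g (x ∷ xs) = trans (cong ((f x ⊖ g x) +ℤ_) (sumℤ-⊖ f g xs)) (⊖-+-⊖ (f x) (g x) _ _)

sum-stepOf : ∀ w {P} → Unique P → sumℤ (map (stepOf w) P) ≡ weightOf copWeight 0 w P ⊖ weightOf prodWeight 0 w P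
sum-stepOf w {P} u = begin
  sumℤ (map (stepOf w) P)                                               ≡⟨ cong sumℤ (map-cong (stepOf≡ w) P) ⟩
  sumℤ (map (λ k → weightAt copWeight 0 w k ⊖ weightAt prodWeight 0 w k) P) ≡⟨ sumℤ-⊖ _ _ P ⟩
  sum (map (weightAt copWeight 0 w) P) ⊖ sum (map (weightAt prodWeight 0 w) P)
    ≡⟨ cong₂ _⊖_ (sum-weightAt copWeight 0 w u) (sum-weightAt prodWeight 0 w u) ⟩
  weightOf copWeight 0 w P ⊖ weightOf prodWeight 0 w P                   ∎
  where open ≡-Reasoning

startsIn : List ℕ → Src → Bool
startsIn P gin = true
startsIn P (out k _) = k ∈ᵇ P

indicator : Bool → ℕ
indicator b = if b then 1 else 0

openWires : List ℕ → List Src → ℕ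
openWires P []       = 0
openWires P (s ∷ ws) = indicator (startsIn P s) + openWires P ws

openWires-middle : ∀ P p {x q} → openWires P (p ++ x ∷ q) ≡ indicator (startsIn P x) + openWires P (p ++ q)
openWires-middle P []          = refl
openWires-middle P (y ∷ p) {x} {q} =
  trans (cong (indicator (startsIn P y) +_) (openWires-middle P p))
        (x∙yz≈y∙xz (indicator (startsIn P y)) (indicator (startsIn P x)) (openWires P (p ++ q)))

from⇒startsIn : ∀ {P} → From P s → startsIn P s ≡ true
from⇒startsIn global    = refl
from⇒startsIn (node k∈) = Equivalence.to T-≡ (∈⇒∈ᵇ k∈)

-- Sweeping the slices upward; pred accounts for the global output edge, which never re-enters P.
prods≤cops+open : ∀ {P E′} → DownClosed E P → (∀ {e} → e ∈ E′ → e ∈ E) → EdgesFrom j ws w E′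
                → weightOf prodWeight j w P ≤ weightOf copWeight j w P + pred (openWires P ws)
prods≤cops+open closed sub output = z≤n
prods≤cops+open {j = j} {P = P} closed sub (coproduct {w = w} {p = p} {s = s} {q = q} r)
  with prods≤cops+open closed (sub ∘ there) r
... | ih rewrite openWires-middle P p {s} {q} | openWires-middle P p {out j L} {out j R ∷ q}
               | openWires-middle P p {out j R} {q}
    with j ∈ᵇ P in j∈ᵇP
... | false = ≤-trans ih (+-monoʳ-≤ C (pred-mono-≤ (m≤n+m (openWires P (p ++ q)) (indicator (startsIn P s)))))
  where C = weightOf copWeight (suc j) w P
... | true rewrite from⇒startsIn (closed (∈ᵇ⇒∈ P (Equivalence.from T-≡ j∈ᵇP)) (inj₁ (sub (here refl)))) =
  subst (weightOf prodWeight (suc j) w P ≤_) (+-suc (weightOf copWeight (suc j) w P) (openWires P (p ++ q))) ih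
prods≤cops+open {j = j} {P = P} closed sub (product {w = w} {p = p} {s = s} {s′ = s′} {q = q} r)
  with prods≤cops+open closed (sub ∘ there ∘ there) r
... | ih rewrite openWires-middle P p {s} {s′ ∷ q} | openWires-middle P p {s′} {q}
               | openWires-middle P p {out j O} {q}
    with j ∈ᵇ P in j∈ᵇP
... | false = ≤-trans ih (+-monoʳ-≤ C (pred-mono-≤ (≤-trans (m≤n+m rest (indicator (startsIn P s′)))
                                                             (m≤n+m _ (indicator (startsIn P s))))))
  where C = weightOf copWeight (suc j) w P
        rest = openWires P (p ++ q)
... | true with ∈ᵇ⇒∈ P (Equivalence.from T-≡ j∈ᵇP)
...   | j∈P rewrite from⇒startsIn (closed j∈P (inj₂ (inj₁ (sub (here refl)))))
                  | from⇒startsIn (closed j∈P (inj₂ (inj₂ (sub (there (here refl)))))) =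
  subst (suc (weightOf prodWeight (suc j) w P) ≤_)
        (sym (+-suc (weightOf copWeight (suc j) w P) (openWires P (p ++ q)))) (s≤s ih)

downClosed⇒prods≤cops : ∀ {P} → EdgesFrom 0 [ gin ] w E → DownClosed E P
                      → weightOf prodWeight 0 w P ≤ weightOf copWeight 0 w P
downClosed⇒prods≤cops {w = w} {P = P} r closed =
  subst (weightOf prodWeight 0 w P ≤_) (+-identityʳ (weightOf copWeight 0 w P)) (prods≤cops+open closed (λ e → e) r)

mainTheorem4 : (n : ℕ) (w : List Op) (E : List (Src × Tgt))
    → edges w ≡ just E
    → countCop w ≡ n
    → countProd w ≡ n
    → IsDyckPath n (steps w E)
mainTheorem4 n w E built cops≡n prods≡n = length-steps , prefixes-nonnegative , total-zero
  where
    run = edgesFrom⇒EdgesFrom 0 [ gin ] w built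
    open IsLinearExtension (labelOrder-isLinearExtension (prograph run))
    order = labelOrder E
    all-cops : weightOf copWeight 0 w order ≡ n
    all-cops = trans (weightOf-covered copWeight 0 w (λ _ → complete)) (trans (sym (countCop≡ w)) cops≡n)
    all-prods : weightOf prodWeight 0 w order ≡ n
    all-prods = trans (weightOf-covered prodWeight 0 w (λ _ → complete)) (trans (sym (countProd≡ w)) prods≡n)
    length-steps : length (steps w E) ≡ 2 * n
    length-steps = trans (length-map (stepOf w) order)
      (trans (length≡cops+prods w unique bounded) (trans (cong₂ _+_ all-cops all-prods) (cong (n +_) (sym (+-identityʳ n)))))
    prefixes-nonnegative : (k : ℕ) → 0ℤ ≤ℤ sumℤ (take k (steps w E))
    prefixes-nonnegative k
      rewrite take-map {f = stepOf w} k order | sum-stepOf w (Unique.take⁺ k unique)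
            = subst (0ℤ ≤ℤ_) (sym (ℤ.≤-⊖ (downClosed⇒prods≤cops run (prefixes k)))) (Int.+≤+ z≤n)
    total-zero : sumℤ (steps w E) ≡ 0ℤ
    total-zero = trans (sum-stepOf w unique) (trans (cong₂ _⊖_ all-cops all-prods) (ℤ.n⊖n≡0 n))
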